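{- Let $D=1$, let $\sigma,\tau\in S_n$, let $k\ge0$, and suppose $(\rho_1,\dots,\rho_k)$ are non-identity permutations in $S_n$ with $\rho_1\cdots\rho_k=\sigma\tau^{ -1}$, $\sum_{i=1}^k\lVert\rho_i\rVert=l$ where $l=\#(\sigma)+\#(\tau)-2$, and the group generated by $\sigma,\tau,\rho_1,\dots,\rho_k$ transitive on $\{1,\dots,n\}$. Then $g(\sigma,\tau^{ -1})=0$ and $l=\ell(\sigma,\tau)$, where $\ell(\sigma,\tau)=\lVert\sigma\tau^{ -1}\rVert+2(|\Pi(\sigma,\tau)|-1)$.
   Context: $\#(\sigma)$ is the number of cycles of $\sigma\in S_n$ and $\lVert\sigma\rVert=n-\#(\sigma)$. $\Pi(\sigma,\tau)$ is the partition of $\{1,\dots,n\}$ into orbits of the group generated by $\sigma,\tau$. The genus $g(\sigma,\tau^{ -1})\ge 0$ of the bipartite map (2-constellation) $(\sigma,\tau^{ -1})$ is defined by $\#(\sigma)+\#(\tau^{ -1})-n+\#(\sigma\tau^{ -1})=2|\Pi(\sigma,\tau)|-2g(\sigma,\tau^{ -1})$. -}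

module Defs where

open import Data.Nat using (ℕ; zero; suc; _∸_; _<ᵇ_)
open import Data.Bool using (Bool; true; false; _∨_; _∧_; not; if_then_else_)
open import Data.Fin using (Fin; zero; suc; toℕ; _≟_)
open import Data.List using (List; []; _∷_; foldr; map)
open import Data.Integer using (ℤ; +_; _-_; _+_; _*_)
open import Relation.Nullary.Decidable using (⌊_⌋)
open import Relation.Binary.PropositionalEquality using (_≡_)
import Data.List.Membership.Propositional
open import Data.Fin.Permutation public
  using (Permutation′; _⟨$⟩ʳ_; _⟨$⟩ˡ_; _∘ₚ_; flip; id; _≈_)

-- Functional composition: (π · ρ) x = π (ρ x)   (ρ applied first)
infixl 7 _·_
_·_ : ∀ {n} → Permutation′ n → Permutation′ n → Permutation′ n
π · ρ = ρ ∘ₚ π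

_⁻¹ : ∀ {n} → Permutation′ n → Permutation′ n
π ⁻¹ = flip π

prod : ∀ {n} → List (Permutation′ n) → Permutation′ n
prod = foldr _·_ id

anyFin : ∀ {n} → (Fin n → Bool) → Bool
anyFin {zero}  f = false
anyFin {suc n} f = f zero ∨ anyFin (λ i → f (suc i))

countFin : ∀ {n} → (Fin n → Bool) → ℕ
countFin {zero}  f = 0
countFin {suc n} f = (if f zero then 1 else 0) Data.Nat.+ countFin (λ i → f (suc i))

anyList : ∀ {A : Set} → (A → Bool) → List A → Bool
anyList p []       = false
anyList p (x ∷ xs) = p x ∨ anyList p xs

-- One closure step adds the images of the current set under
-- each generator and each inverse generator; n steps suffice to reach the
-- full orbit of a point in an n-element set.
closeStep : ∀ {n} → List (Permutation′ n) → (Fin n → Bool) → (Fin n → Bool)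
closeStep gs S j = S j ∨ anyList (λ g → S (g ⟨$⟩ˡ j) ∨ S (g ⟨$⟩ʳ j)) gs

iterate : ∀ {A : Set} → ℕ → (A → A) → A → A
iterate zero    f a = a
iterate (suc k) f a = f (iterate k f a)

inOrbit : ∀ {n} → List (Permutation′ n) → Fin n → Fin n → Bool
inOrbit {n} gs i = iterate n (closeStep gs) (λ j → ⌊ j ≟ i ⌋)

-- number of orbits of ⟨gs⟩ on Fin n: count the points that are the least
-- element of their orbit
numOrbits : ∀ {n} → List (Permutation′ n) → ℕ
numOrbits gs = countFin (λ i → not (anyFin (λ j → (toℕ j <ᵇ toℕ i) ∧ inOrbit gs i j)))

cycles : ∀ {n} → Permutation′ n → ℕ
cycles σ = numOrbits (σ ∷ [])

‖_‖ : ∀ {n} → Permutation′ n → ℕ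
‖_‖ {n} σ = n ∸ cycles σ

numΠ : ∀ {n} → Permutation′ n → Permutation′ n → ℕ
numΠ σ τ = numOrbits (σ ∷ τ ∷ [])

data Reach {n} (gs : List (Permutation′ n)) : Fin n → Fin n → Set where
  here : ∀ {i} → Reach gs i i
  fwd  : ∀ {i j} g → g Data.List.Membership.Propositional.∈ gs →
         Reach gs i j → Reach gs i (g ⟨$⟩ʳ j)
  bwd  : ∀ {i j} g → g Data.List.Membership.Propositional.∈ gs →
         Reach gs i j → Reach gs i (g ⟨$⟩ˡ j)

Transitive : ∀ {n} → List (Permutation′ n) → Set
Transitive {n} gs = ∀ (i j : Fin n) → Reach gs i j

IsGenus : ∀ {n} → Permutation′ n → Permutation′ n → ℤ → Set
IsGenus {n} σ τ g =
  (+ cycles σ + + cycles (τ ⁻¹) - + n + + cycles (σ · τ ⁻¹))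
    ≡ + 2 * + numΠ σ τ - + 2 * g

ℓ : ∀ {n} → Permutation′ n → Permutation′ n → ℤ
ℓ σ τ = + ‖ σ · τ ⁻¹ ‖ + + 2 * (+ numΠ σ τ - + 1)

-- Write π = σ τ⁻¹.  For permutations a, b and a list R of further generators,
--   ‖a b‖ + 2 (|orbits of ⟨a b, R⟩| − |orbits of ⟨a, b, R⟩|) ≤ ‖a‖ + ‖b‖,
-- by induction on ‖b‖: peel a transposition t off b; multiplying by t changes the number of
-- cycles by one, and adding t as a generator changes the number of orbits by at most one, in
-- compatible directions.  For a = σ, b = τ⁻¹ this is g(σ, τ⁻¹) ≥ 0, i.e. #(σ) + #(τ) − 2 ≤ ℓ(σ, τ).
-- Iterated along ρ₁ ⋯ ρₖ = π, with ⟨σ, τ, ρ₁, …, ρₖ⟩ transitive, it gives ℓ(σ, τ) ≤ ∑ ‖ρᵢ‖ = l.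
-- Since l = #(σ) + #(τ) − 2, both inequalities are equalities.

module Submission where

open import Defs
open import Data.Empty using (⊥-elim)
open import Data.List using (List; []; _∷_; _++_; map)
open import Data.List.Membership.Propositional using (_∈_)
open import Data.List.Relation.Unary.Any using (here; there)
open import Data.Product using (∃; _×_; _,_)
open import Data.Sum using (_⊎_; inj₁; inj₂)
open import Relation.Nullary using (¬_; Dec; yes; no)
open import Relation.Binary.PropositionalEquality

module OrbitCounting where
  open import Data.Bool using (Bool; true; false; T; not; _∧_)
  open import Data.Bool.Properties using (T?; T-∨; T-∧)
  open import Function.Bundles using (module Equivalence)
  open import Data.Fin using (Fin; zero; suc; toℕ; _≟_)
  open import Data.Fin.Properties using (toℕ-injective; suc-injective; all?; ¬∀⟶∃¬; pigeonhole)
  open import Data.Fin.Permutation using (inverseˡ; inverseʳ; transpose)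
  open import Data.List.Relation.Binary.Permutation.Propositional using (_↭_; ↭-sym; ↭-refl; ↭-swap)
  open import Data.List.Relation.Binary.Permutation.Propositional.Properties using (∈-resp-↭; shift; ++-comm)
  open import Data.Nat.ListAction using (sum)
  open import Data.Nat using (ℕ; zero; suc; _+_; _*_; _∸_; _≤_; _<_; z≤n; s≤s; _<ᵇ_)
  open import Data.Nat.Properties
    using (≤-refl; ≤-reflexive; ≤-trans; ≤-antisym; <-trans; <-irrefl; <-≤-trans; ≤-pred; <-cmp;
           m≤n⇒m≤1+n; m<n⇒m<1+n; n<1+n; <ᵇ⇒<; <⇒<ᵇ; m≤n⇒∃[o]m+o≡n; m∸n+n≡m;
           +-identityʳ; +-assoc; +-comm; +-suc; +-mono-≤; +-monoˡ-≤; +-monoʳ-≤; +-cancelʳ-≤;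
           module ≤-Reasoning)
  open import Data.Nat.Tactic.RingSolver using (solve-∀)
  open import Function using (_∘_)
  open Equivalence using (to; from)
  open import Relation.Binary.Definitions using (tri<; tri≈; tri>)
  open import Relation.Nullary.Decidable using (⌊_⌋; map′; _→-dec_; fromWitness; toWitness)

  private variable
    n : ℕ
    gs hs : List (Permutation′ n)

  T-not⁻ : ∀ b → T (not b) → ¬ T b
  T-not⁻ false _ ()

  T-not⁺ : ∀ b → ¬ T b → T (not b)
  T-not⁺ true  ¬t = ¬t _
  T-not⁺ false _  = _

  T-ext : ∀ {a b} → (T a → T b) → (T b → T a) → a ≡ b
  T-ext {true}  {true}  _ _ = refl
  T-ext {true}  {false} f _ = ⊥-elim (f _)
  T-ext {false} {true}  _ g = ⊥-elim (g _)
  T-ext {false} {false} _ _ = refl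

  countFin-≤ : (f : Fin n → Bool) → countFin f ≤ n
  countFin-≤ {zero}  f = z≤n
  countFin-≤ {suc n} f with f zero
  ... | true  = s≤s (countFin-≤ (f ∘ suc))
  ... | false = m≤n⇒m≤1+n (countFin-≤ (f ∘ suc))

  countFin-mono : (f g : Fin n → Bool) → (∀ i → T (f i) → T (g i)) → countFin f ≤ countFin g
  countFin-mono {zero}  f g f⊆g = z≤n
  countFin-mono {suc n} f g f⊆g with f zero | g zero | f⊆g zero
  ... | true  | true  | _ = s≤s (countFin-mono (f ∘ suc) (g ∘ suc) (f⊆g ∘ suc))
  ... | true  | false | h = ⊥-elim (h _)
  ... | false | true  | _ = m≤n⇒m≤1+n (countFin-mono (f ∘ suc) (g ∘ suc) (f⊆g ∘ suc))
  ... | false | false | _ = countFin-mono (f ∘ suc) (g ∘ suc) (f⊆g ∘ suc)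

  countFin-< : (f g : Fin n → Bool) → (∀ i → T (f i) → T (g i)) →
               ∀ j → ¬ T (f j) → T (g j) → countFin f < countFin g
  countFin-< f g f⊆g zero ¬fj gj with f zero | g zero
  ... | true  | _     = ⊥-elim (¬fj _)
  ... | false | true  = s≤s (countFin-mono (f ∘ suc) (g ∘ suc) (f⊆g ∘ suc))
  countFin-< f g f⊆g (suc j) ¬fj gj with f zero | g zero | f⊆g zero
  ... | true  | true  | _ = s≤s (countFin-< (f ∘ suc) (g ∘ suc) (f⊆g ∘ suc) j ¬fj gj)
  ... | true  | false | h = ⊥-elim (h _)
  ... | false | true  | _ = m<n⇒m<1+n (countFin-< (f ∘ suc) (g ∘ suc) (f⊆g ∘ suc) j ¬fj gj)
  ... | false | false | _ = countFin-< (f ∘ suc) (g ∘ suc) (f⊆g ∘ suc) j ¬fj gj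

  countFin-cong : (f g : Fin n → Bool) → (∀ i → f i ≡ g i) → countFin f ≡ countFin g
  countFin-cong {zero}  f g f≡g = refl
  countFin-cong {suc n} f g f≡g rewrite f≡g zero =
    cong (_ +_) (countFin-cong (f ∘ suc) (g ∘ suc) (f≡g ∘ suc))

  countFin-full : (f : Fin n → Bool) → (∀ i → T (f i)) → countFin f ≡ n
  countFin-full {zero}  f all = refl
  countFin-full {suc n} f all with f zero | all zero
  ... | true | _ = cong suc (countFin-full (f ∘ suc) (all ∘ suc))

  countFin-empty : (f : Fin n → Bool) → (∀ i → ¬ T (f i)) → countFin f ≡ 0
  countFin-empty {zero}  f none = refl
  countFin-empty {suc n} f none with f zero | none zero
  ... | true  | ¬t = ⊥-elim (¬t _)
  ... | false | _  = countFin-empty (f ∘ suc) (none ∘ suc)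

  countFin-remove : (f g : Fin n → Bool) (k : Fin n) → T (f k) → ¬ T (g k) →
                    (∀ i → i ≢ k → g i ≡ f i) → suc (countFin g) ≡ countFin f
  countFin-remove f g zero fk ¬gk g≡f with f zero | g zero
  ... | true | false = cong suc (countFin-cong (g ∘ suc) (f ∘ suc) (λ i → g≡f (suc i) λ ()))
  ... | true | true  = ⊥-elim (¬gk _)
  countFin-remove f g (suc k) fk ¬gk g≡f rewrite g≡f zero (λ ()) with f zero
  ... | true  = cong suc (countFin-remove (f ∘ suc) (g ∘ suc) k fk ¬gk λ i i≢k → g≡f (suc i) (i≢k ∘ suc-injective))
  ... | false = countFin-remove (f ∘ suc) (g ∘ suc) k fk ¬gk λ i i≢k → g≡f (suc i) (i≢k ∘ suc-injective)

  anyFin⁻ : (f : Fin n → Bool) → T (anyFin f) → ∃ λ i → T (f i)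
  anyFin⁻ {suc n} f t with to T-∨ t
  ... | inj₁ t₀ = zero , t₀
  ... | inj₂ tₛ with anyFin⁻ (f ∘ suc) tₛ
  ... | i , tᵢ = suc i , tᵢ

  anyFin⁺ : (f : Fin n → Bool) (i : Fin n) → T (f i) → T (anyFin f)
  anyFin⁺ f zero    t = from T-∨ (inj₁ t)
  anyFin⁺ f (suc i) t = from T-∨ (inj₂ (anyFin⁺ (f ∘ suc) i t))

  anyList⁻ : ∀ {A : Set} (p : A → Bool) xs → T (anyList p xs) → ∃ λ x → x ∈ xs × T (p x)
  anyList⁻ p (x ∷ xs) t with to T-∨ t
  ... | inj₁ tₓ = x , here refl , tₓ
  ... | inj₂ tₛ with anyList⁻ p xs tₛ
  ... | y , y∈xs , t′ = y , there y∈xs , t′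

  anyList⁺ : ∀ {A : Set} (p : A → Bool) {xs x} → x ∈ xs → T (p x) → T (anyList p xs)
  anyList⁺ p (here refl) t = from T-∨ (inj₁ t)
  anyList⁺ p (there x∈xs) t = from T-∨ (inj₂ (anyList⁺ p x∈xs t))

  Reach-trans : ∀ {i j k} → Reach gs i j → Reach gs j k → Reach gs i k
  Reach-trans r here        = r
  Reach-trans r (fwd g m s) = fwd g m (Reach-trans r s)
  Reach-trans r (bwd g m s) = bwd g m (Reach-trans r s)

  Reach-step : ∀ {g} → g ∈ gs → ∀ j → Reach gs j (g ⟨$⟩ʳ j)
  Reach-step g∈gs j = fwd _ g∈gs here

  Reach-stepˡ : ∀ {g} → g ∈ gs → ∀ j → Reach gs j (g ⟨$⟩ˡ j)
  Reach-stepˡ g∈gs j = bwd _ g∈gs here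

  Reach-sym : ∀ {i j} → Reach gs i j → Reach gs j i
  Reach-sym here        = here
  Reach-sym (fwd {j = j} g m r) =
    Reach-trans (subst (Reach _ (g ⟨$⟩ʳ j)) (inverseˡ g) (Reach-stepˡ m _)) (Reach-sym r)
  Reach-sym (bwd {j = j} g m r) =
    Reach-trans (subst (Reach _ (g ⟨$⟩ˡ j)) (inverseʳ g) (fwd g m here)) (Reach-sym r)

  _⊑_ : List (Permutation′ n) → List (Permutation′ n) → Set
  gs ⊑ hs = ∀ {g} → g ∈ gs → ∀ j → Reach hs j (g ⟨$⟩ʳ j)

  Reach-⊑ : gs ⊑ hs → ∀ {i j} → Reach gs i j → Reach hs i j
  Reach-⊑ gs⊑hs here        = here
  Reach-⊑ gs⊑hs (fwd g m r) = Reach-trans (Reach-⊑ gs⊑hs r) (gs⊑hs m _)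
  Reach-⊑ gs⊑hs (bwd {j = j} g m r) =
    Reach-trans (Reach-⊑ gs⊑hs r)
      (Reach-sym (subst (Reach _ (g ⟨$⟩ˡ j)) (inverseʳ g) (gs⊑hs m (g ⟨$⟩ˡ j))))

  ⊆⇒⊑ : (∀ {g} → g ∈ gs → g ∈ hs) → gs ⊑ hs
  ⊆⇒⊑ gs⊆hs g∈gs = Reach-step (gs⊆hs g∈gs)

  module InOrbit (gs : List (Permutation′ n)) (i : Fin n) where

    stage : ℕ → Fin n → Bool
    stage k = iterate k (closeStep gs) (λ j → ⌊ j ≟ i ⌋)

    Closed : (Fin n → Bool) → Set
    Closed S = ∀ j → T (closeStep gs S j) → T (S j)

    closedAt? : ∀ S j → Dec (T (closeStep gs S j) → T (S j))
    closedAt? S j = T? (closeStep gs S j) →-dec T? (S j)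

    stage-sound : ∀ k j → T (stage k j) → Reach gs i j
    stage-sound zero    j t with toWitness t
    ... | refl = here
    stage-sound (suc k) j t with to T-∨ t
    ... | inj₁ t′ = stage-sound k j t′
    ... | inj₂ t′ with anyList⁻ _ gs t′
    ... | g , g∈gs , t″ with to T-∨ t″
    ... | inj₁ tˡ = subst (Reach gs i) (inverseʳ g) (fwd g g∈gs (stage-sound k _ tˡ))
    ... | inj₂ tʳ = subst (Reach gs i) (inverseˡ g) (bwd g g∈gs (stage-sound k _ tʳ))

    closed-complete : ∀ S → Closed S → T (S i) → ∀ {j} → Reach gs i j → T (S j)
    closed-complete S closed tᵢ here = tᵢ
    closed-complete S closed tᵢ (fwd g m r) =
      closed _ (from T-∨ (inj₂ (anyList⁺ _ m
        (from T-∨ (inj₁ (subst (T ∘ S) (sym (inverseˡ g)) (closed-complete S closed tᵢ r)))))))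
    closed-complete S closed tᵢ (bwd g m r) =
      closed _ (from T-∨ (inj₂ (anyList⁺ _ m
        (from T-∨ (inj₂ (subst (T ∘ S) (sym (inverseʳ g)) (closed-complete S closed tᵢ r)))))))

    stage-mono : ∀ d k j → T (stage k j) → T (stage (d + k) j)
    stage-mono zero    k j t = t
    stage-mono (suc d) k j t = from T-∨ (inj₁ (stage-mono d k j t))

    stage-start : ∀ k → T (stage k i)
    stage-start k = subst (λ m → T (stage m i)) (+-identityʳ k) (stage-mono k 0 i (fromWitness refl))

    -- Until it becomes closed, every stage adds a point, so some stage ≤ n is closed.
    stage-growth : ∀ k → (∃ λ k′ → k′ ≤ k × Closed (stage k′)) ⊎ suc k ≤ countFin (stage k)
    stage-growth zero = inj₂ (subst (_< countFin (stage 0)) (countFin-empty {n} (λ _ → false) (λ _ ()))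
                               (countFin-< {n} (λ _ → false) (stage 0) (λ _ ()) i (λ ()) (stage-start 0)))
    stage-growth (suc k) with stage-growth k
    ... | inj₁ (k′ , k′≤k , closed) = inj₁ (k′ , m≤n⇒m≤1+n k′≤k , closed)
    ... | inj₂ grown with all? (closedAt? (stage k))
    ... | yes closed = inj₁ (k , m≤n⇒m≤1+n ≤-refl , closed)
    ... | no ¬closed with ¬∀⟶∃¬ n _ (closedAt? (stage k)) ¬closed
    ... | j , ¬step⇒ = inj₂ (≤-trans (s≤s grown)
            (countFin-< (stage k) (stage (suc k)) (λ j → from T-∨ ∘ inj₁) j
               (λ t → ¬step⇒ (λ _ → t)) (new-point (T? (closeStep gs (stage k) j)))))
      where
        new-point : Dec (T (closeStep gs (stage k) j)) → T (stage (suc k) j)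
        new-point (yes t) = t
        new-point (no ¬t) = ⊥-elim (¬step⇒ (λ t → ⊥-elim (¬t t)))

    stage-complete : ∀ {j} → Reach gs i j → T (stage n j)
    stage-complete {j} r with stage-growth n
    ... | inj₂ too-big = ⊥-elim (<-irrefl refl (<-≤-trans too-big (countFin-≤ (stage n))))
    ... | inj₁ (k′ , k′≤n , closed) =
      subst (λ m → T (stage m j)) (m∸n+n≡m k′≤n)
        (stage-mono (n ∸ k′) k′ j (closed-complete (stage k′) closed (stage-start k′) r))

  inOrbit-sound : ∀ gs (i j : Fin n) → T (inOrbit gs i j) → Reach gs i j
  inOrbit-sound {n} gs i = InOrbit.stage-sound gs i n

  inOrbit-complete : ∀ gs (i j : Fin n) → Reach gs i j → T (inOrbit gs i j)
  inOrbit-complete gs i j = InOrbit.stage-complete gs i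

  Reach? : ∀ gs (i j : Fin n) → Dec (Reach gs i j)
  Reach? gs i j = map′ (inOrbit-sound gs i j) (inOrbit-complete gs i j) (T? _)

  -- Counting orbits by their least points

  IsLeast : List (Permutation′ n) → Fin n → Set
  IsLeast gs i = ∀ j → toℕ j < toℕ i → ¬ Reach gs i j

  smallerᵇ : List (Permutation′ n) → Fin n → Fin n → Bool
  smallerᵇ gs i j = (toℕ j <ᵇ toℕ i) ∧ inOrbit gs i j

  -- numOrbits gs is, definitionally, countFin (leastᵇ gs)
  leastᵇ : List (Permutation′ n) → Fin n → Bool
  leastᵇ gs i = not (anyFin (smallerᵇ gs i))

  smallerᵇ⁻ : ∀ gs (i j : Fin n) → T (smallerᵇ gs i j) → toℕ j < toℕ i × Reach gs i j
  smallerᵇ⁻ gs i j t with to T-∧ t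
  ... | j<i , r = <ᵇ⇒< _ _ j<i , inOrbit-sound gs i j r

  leastᵇ⇒IsLeast : ∀ gs (i : Fin n) → T (leastᵇ gs i) → IsLeast gs i
  leastᵇ⇒IsLeast gs i t j j<i r =
    T-not⁻ _ t (anyFin⁺ _ j (from T-∧ (<⇒<ᵇ j<i , inOrbit-complete gs i j r)))

  IsLeast⇒leastᵇ : ∀ gs (i : Fin n) → IsLeast gs i → T (leastᵇ gs i)
  IsLeast⇒leastᵇ gs i least = T-not⁺ _ λ t →
    let j , smaller = anyFin⁻ _ t
        j<i , i~j   = smallerᵇ⁻ gs i j smaller
    in least j j<i i~j

  least-exists : ∀ gs (x : Fin n) → ∃ λ m → Reach gs x m × IsLeast gs m
  least-exists gs x = descend (suc (toℕ x)) x (n<1+n _) here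
    where
      descend : ∀ bound j → toℕ j < bound → Reach gs x j → ∃ λ m → Reach gs x m × IsLeast gs m
      descend (suc bound) j j<bound r with T? (anyFin (smallerᵇ gs j))
      ... | no ¬t = j , r , leastᵇ⇒IsLeast gs j (T-not⁺ _ ¬t)
      ... | yes t with anyFin⁻ _ t
      ... | k , sm with smallerᵇ⁻ gs j k sm
      ... | k<j , j~k = descend bound k (<-≤-trans k<j (≤-pred j<bound)) (Reach-trans r j~k)

  least-unique : ∀ gs {m m′ : Fin n} → IsLeast gs m → IsLeast gs m′ → Reach gs m m′ → m ≡ m′
  least-unique gs {m} {m′} least least′ r with <-cmp (toℕ m) (toℕ m′)
  ... | tri< m<m′ _ _ = ⊥-elim (least′ m m<m′ (Reach-sym r))
  ... | tri≈ _ m≡m′ _ = toℕ-injective m≡m′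
  ... | tri> _ _ m′<m = ⊥-elim (least m′ m′<m r)

  numOrbits-anti : ∀ gs hs → gs ⊑ hs → numOrbits {n} hs ≤ numOrbits gs
  numOrbits-anti gs hs gs⊑hs = countFin-mono (leastᵇ hs) (leastᵇ gs) λ i t →
    IsLeast⇒leastᵇ gs i λ j j<i r → leastᵇ⇒IsLeast hs i t j j<i (Reach-⊑ gs⊑hs r)

  numOrbits-cong : ∀ gs hs → gs ⊑ hs → hs ⊑ gs → numOrbits {n} gs ≡ numOrbits hs
  numOrbits-cong gs hs gs⊑hs hs⊑gs = ≤-antisym (numOrbits-anti hs gs hs⊑gs) (numOrbits-anti gs hs gs⊑hs)

  numOrbits-↭ : gs ↭ hs → numOrbits gs ≡ numOrbits hs
  numOrbits-↭ {gs = gs} {hs} gs↭hs =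
    numOrbits-cong gs hs (⊆⇒⊑ (∈-resp-↭ gs↭hs)) (⊆⇒⊑ (∈-resp-↭ (↭-sym gs↭hs)))

  numOrbits-redundant : ∀ g → (∀ j → Reach gs j (g ⟨$⟩ʳ j)) → numOrbits (g ∷ gs) ≡ numOrbits gs
  numOrbits-redundant {gs = gs} g g-inside = numOrbits-cong (g ∷ gs) gs
    (λ { (here refl) → g-inside ; (there m) → Reach-step m })
    (⊆⇒⊑ there)

  numOrbits-∷-≈ : ∀ (g h : Permutation′ n) gs → g ≈ h → numOrbits (g ∷ gs) ≡ numOrbits (h ∷ gs)
  numOrbits-∷-≈ g h gs g≈h = numOrbits-cong (g ∷ gs) (h ∷ gs)
    (λ { (here refl) j → subst (Reach _ j) (sym (g≈h j)) (Reach-step (here refl) j)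
       ; (there m) → Reach-step (there m) })
    (λ { (here refl) j → subst (Reach _ j) (g≈h j) (Reach-step (here refl) j)
       ; (there m) → Reach-step (there m) })

  cycles-cong : ∀ (g h : Permutation′ n) → g ≈ h → cycles g ≡ cycles h
  cycles-cong g h = numOrbits-∷-≈ g h []

  cycles-≤ : (g : Permutation′ n) → cycles g ≤ n
  cycles-≤ g = countFin-≤ _

  numOrbits-[] : numOrbits {n} [] ≡ n
  numOrbits-[] = countFin-full (leastᵇ []) λ i →
    IsLeast⇒leastᵇ [] i λ { j j<i here → <-irrefl refl j<i }

  cycles-id : ∀ (g : Permutation′ n) → g ≈ id → cycles g ≡ n
  cycles-id g g≈id =
    trans (numOrbits-redundant g λ j → subst (Reach [] j) (sym (g≈id j)) here) numOrbits-[]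

  cycles-⁻¹ : (g : Permutation′ n) → cycles (g ⁻¹) ≡ cycles g
  cycles-⁻¹ g = numOrbits-cong (g ⁻¹ ∷ []) (g ∷ [])
    (λ { (here refl) → Reach-stepˡ (here refl) })
    (λ { (here refl) → Reach-stepˡ (here refl) })

  numOrbits-transitive : ∀ {k} (gs : List (Permutation′ (suc k))) → Transitive gs → numOrbits gs ≡ 1
  numOrbits-transitive gs all-reach
    with leastᵇ gs zero | IsLeast⇒leastᵇ gs zero (λ _ ())
  ... | true | _ = cong suc (countFin-empty _ λ i t →
                    leastᵇ⇒IsLeast gs (suc i) t zero (s≤s z≤n) (all-reach (suc i) zero))

  -- Transpositions as generators and as factors

  data TransposeView (x y : Fin n) : Fin n → Fin n → Set where
    at-x  : TransposeView x y x y
    at-y  : TransposeView x y y x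
    other : ∀ {k} → k ≢ x → k ≢ y → TransposeView x y k k

  transpose-view : ∀ (x y k : Fin n) → TransposeView x y k (transpose x y ⟨$⟩ʳ k)
  transpose-view x y k with k ≟ x
  ... | yes refl = at-x
  ... | no k≢x with k ≟ y
  ...   | yes refl = at-y
  ...   | no k≢y   = other k≢x k≢y

  transpose-x : ∀ (x y : Fin n) → transpose x y ⟨$⟩ʳ x ≡ y
  transpose-x x y with transpose x y ⟨$⟩ʳ x | transpose-view x y x
  ... | _ | at-x          = refl
  ... | _ | at-y          = refl
  ... | _ | other x≢x _   = ⊥-elim (x≢x refl)

  transpose-y : ∀ (x y : Fin n) → transpose x y ⟨$⟩ʳ y ≡ x
  transpose-y x y with transpose x y ⟨$⟩ʳ y | transpose-view x y y
  ... | _ | at-x          = refl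
  ... | _ | at-y          = refl
  ... | _ | other _ y≢y   = ⊥-elim (y≢y refl)

  transpose-other : ∀ (x y k : Fin n) → k ≢ x → k ≢ y → transpose x y ⟨$⟩ʳ k ≡ k
  transpose-other x y k k≢x k≢y with transpose x y ⟨$⟩ʳ k | transpose-view x y k
  ... | _ | at-x      = ⊥-elim (k≢x refl)
  ... | _ | at-y      = ⊥-elim (k≢y refl)
  ... | _ | other _ _ = refl

  transpose-involutive : ∀ (x y k : Fin n) → transpose x y ⟨$⟩ʳ (transpose x y ⟨$⟩ʳ k) ≡ k
  transpose-involutive x y k with transpose x y ⟨$⟩ʳ k | transpose-view x y k
  ... | _ | at-x          = transpose-y x y
  ... | _ | at-y          = transpose-x x y
  ... | _ | other k≢x k≢y = transpose-other x y k k≢x k≢y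

  transpose-within : ∀ {x y : Fin n} → Reach hs x y → ∀ k → Reach hs k (transpose x y ⟨$⟩ʳ k)
  transpose-within {x = x} {y} x~y k with transpose x y ⟨$⟩ʳ k | transpose-view x y k
  ... | _ | at-x      = x~y
  ... | _ | at-y      = Reach-sym x~y
  ... | _ | other _ _ = here

  ReachJoined : List (Permutation′ n) → Fin n → Fin n → Fin n → Fin n → Set
  ReachJoined gs x y i j = Reach gs i j ⊎ (Reach gs i x × Reach gs y j) ⊎ (Reach gs i y × Reach gs x j)

  module _ {gs : List (Permutation′ n)} {x y : Fin n} where

    ReachJoined-swap : ∀ {i j} → ReachJoined gs x y i j → ReachJoined gs y x i j
    ReachJoined-swap (inj₁ r)        = inj₁ r
    ReachJoined-swap (inj₂ (inj₁ p)) = inj₂ (inj₂ p)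
    ReachJoined-swap (inj₂ (inj₂ p)) = inj₂ (inj₁ p)

    ReachJoined-extend : ∀ {i j k} → ReachJoined gs x y i j → Reach gs j k → ReachJoined gs x y i k
    ReachJoined-extend (inj₁ r)              s = inj₁ (Reach-trans r s)
    ReachJoined-extend (inj₂ (inj₁ (p , q))) s = inj₂ (inj₁ (p , Reach-trans q s))
    ReachJoined-extend (inj₂ (inj₂ (p , q))) s = inj₂ (inj₂ (p , Reach-trans q s))

    ReachJoined-transpose : ∀ {i} k → ReachJoined gs x y i k → ReachJoined gs x y i (transpose x y ⟨$⟩ʳ k)
    ReachJoined-transpose k rj with transpose x y ⟨$⟩ʳ k | transpose-view x y k | rj
    ... | _ | at-x      | inj₁ r              = inj₂ (inj₁ (r , here))
    ... | _ | at-x      | inj₂ (inj₁ (p , _)) = inj₂ (inj₁ (p , here))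
    ... | _ | at-x      | inj₂ (inj₂ (p , _)) = inj₁ p
    ... | _ | at-y      | inj₁ r              = inj₂ (inj₂ (r , here))
    ... | _ | at-y      | inj₂ (inj₁ (p , _)) = inj₁ p
    ... | _ | at-y      | inj₂ (inj₂ (p , _)) = inj₂ (inj₂ (p , here))
    ... | _ | other _ _ | _                   = rj

  Reach-transpose∷ : ∀ {x y i j : Fin n} → Reach (transpose x y ∷ gs) i j → ReachJoined gs x y i j
  Reach-transpose∷ here = inj₁ here
  Reach-transpose∷ (fwd _ (here refl) r) = ReachJoined-transpose _ (Reach-transpose∷ r)
  Reach-transpose∷ (bwd _ (here refl) r) =
    ReachJoined-swap (ReachJoined-transpose _ (ReachJoined-swap (Reach-transpose∷ r)))
  Reach-transpose∷ (fwd g (there m) r) = ReachJoined-extend (Reach-transpose∷ r) (Reach-step m _)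
  Reach-transpose∷ (bwd g (there m) r) = ReachJoined-extend (Reach-transpose∷ r) (Reach-stepˡ m _)

  -- When hs is gs with a and b joined, exactly the larger of the least representatives
  -- ma < mb of their gs-orbits stops being least.
  numOrbits-join-< : ∀ gs hs {a b ma mb : Fin n} → gs ⊑ hs →
                     (∀ {i j} → Reach hs i j → ReachJoined gs a b i j) → Reach hs a b →
                     Reach gs a ma → IsLeast gs ma → Reach gs b mb → IsLeast gs mb → toℕ ma < toℕ mb →
                     suc (numOrbits hs) ≡ numOrbits gs
  numOrbits-join-< gs hs {a} {b} {ma} {mb} gs⊑hs joined a~b a~ma least-ma b~mb least-mb ma<mb =
    countFin-remove (leastᵇ gs) (leastᵇ hs) mb (IsLeast⇒leastᵇ gs mb least-mb)
      (λ t → leastᵇ⇒IsLeast hs mb t ma ma<mb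
               (Reach-trans (Reach-⊑ gs⊑hs (Reach-sym b~mb)) (Reach-trans (Reach-sym a~b) (Reach-⊑ gs⊑hs a~ma))))
      λ i i≢mb → T-ext
        (λ t → IsLeast⇒leastᵇ gs i λ j j<i r → leastᵇ⇒IsLeast hs i t j j<i (Reach-⊑ gs⊑hs r))
        (λ t → IsLeast⇒leastᵇ hs i λ j j<i r → stays-least i i≢mb (leastᵇ⇒IsLeast gs i t) j j<i (joined r))
    where
      stays-least : ∀ i → i ≢ mb → IsLeast gs i → ∀ j → toℕ j < toℕ i → ¬ ReachJoined gs a b i j
      stays-least i i≢mb least-i j j<i (inj₁ r) = least-i j j<i r
      stays-least i i≢mb least-i j j<i (inj₂ (inj₁ (i~a , b~j)))
        with least-unique gs least-i least-ma (Reach-trans i~a a~ma)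
      ... | refl = least-mb j (<-trans j<i ma<mb) (Reach-trans (Reach-sym b~mb) b~j)
      stays-least i i≢mb least-i j j<i (inj₂ (inj₂ (i~b , _))) =
        i≢mb (least-unique gs least-i least-mb (Reach-trans i~b b~mb))

  numOrbits-join : ∀ gs hs {x y : Fin n} → gs ⊑ hs → (∀ {i j} → Reach hs i j → ReachJoined gs x y i j) →
                   Reach hs x y → ¬ Reach gs x y → suc (numOrbits hs) ≡ numOrbits gs
  numOrbits-join gs hs {x} {y} gs⊑hs joined x~y ¬x~y
    with least-exists gs x | least-exists gs y
  ... | mx , x~mx , least-mx | my , y~my , least-my with <-cmp (toℕ mx) (toℕ my)
  ... | tri< mx<my _ _ =
    numOrbits-join-< gs hs gs⊑hs joined x~y x~mx least-mx y~my least-my mx<my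
  ... | tri> _ _ my<mx =
    numOrbits-join-< gs hs gs⊑hs (ReachJoined-swap ∘ joined) (Reach-sym x~y) y~my least-my x~mx least-mx my<mx
  ... | tri≈ _ mx≡my _ with toℕ-injective mx≡my
  ...   | refl = ⊥-elim (¬x~y (Reach-trans x~mx (Reach-sym y~my)))

  numOrbits-transpose∷-separated : ∀ gs {x y : Fin n} → ¬ Reach gs x y →
                                   suc (numOrbits (transpose x y ∷ gs)) ≡ numOrbits gs
  numOrbits-transpose∷-separated gs {x} {y} ¬x~y =
    numOrbits-join gs (transpose x y ∷ gs) (⊆⇒⊑ there) Reach-transpose∷
      (subst (Reach _ x) (transpose-x x y) (Reach-step (here refl) x)) ¬x~y

  numOrbits-transpose∷-connected : ∀ gs {x y : Fin n} → Reach gs x y →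
                                   numOrbits (transpose x y ∷ gs) ≡ numOrbits gs
  numOrbits-transpose∷-connected gs {x} {y} x~y =
    numOrbits-redundant (transpose x y) (transpose-within x~y)

  numOrbits-≤-transpose∷ : ∀ gs (x y : Fin n) → numOrbits gs ≤ suc (numOrbits (transpose x y ∷ gs))
  numOrbits-≤-transpose∷ gs x y with Reach? gs x y
  ... | yes x~y = m≤n⇒m≤1+n (≤-reflexive (sym (numOrbits-transpose∷-connected gs x~y)))
  ... | no ¬x~y = ≤-reflexive (sym (numOrbits-transpose∷-separated gs ¬x~y))

  iterate-+ : ∀ {A : Set} (f : A → A) a b x → iterate (a + b) f x ≡ iterate a f (iterate b f x)
  iterate-+ f zero    b x = refl
  iterate-+ f (suc a) b x = cong f (iterate-+ f a b x)

  iterate-injective : (c : Permutation′ n) → ∀ a {j k} →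
                      iterate a (c ⟨$⟩ʳ_) j ≡ iterate a (c ⟨$⟩ʳ_) k → j ≡ k
  iterate-injective c zero    eq = eq
  iterate-injective c (suc a) eq =
    iterate-injective c a (trans (sym (inverseˡ c)) (trans (cong (c ⟨$⟩ˡ_) eq) (inverseˡ c)))

  iterate-period : (c : Permutation′ n) → ∀ y → ∃ λ k → iterate (suc k) (c ⟨$⟩ʳ_) y ≡ y
  iterate-period {n} c y with pigeonhole (n<1+n n) (λ (i : Fin (suc n)) → iterate (toℕ i) (c ⟨$⟩ʳ_) y)
  ... | i , j , i<j , cⁱy≡cʲy with m≤n⇒∃[o]m+o≡n i<j
  ... | k , i+1+k≡j = k , iterate-injective c (toℕ i)
        (trans (sym (iterate-+ _ (toℕ i) (suc k) y))
          (trans (cong (λ m → iterate m (c ⟨$⟩ʳ_) y) (trans (+-suc (toℕ i) k) i+1+k≡j)) (sym cⁱy≡cʲy)))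

  Reach-iterate : (c : Permutation′ n) → ∀ y k → Reach (c ∷ []) y (iterate k (c ⟨$⟩ʳ_) y)
  Reach-iterate c y zero    = here
  Reach-iterate c y (suc k) = fwd c (here refl) (Reach-iterate c y k)

  module _ (c : Permutation′ n) {x y : Fin n} (¬x~y : ¬ Reach (c ∷ []) x y) where
    private
      t = transpose x y
      ct = c · t

    -- c · t runs through x, then along the c-cycle of y until it returns to y.
    ·-transpose-walk : ∀ k → Reach (ct ∷ []) x y ⊎ Reach (ct ∷ []) x (iterate (suc k) (c ⟨$⟩ʳ_) y)
    ·-transpose-walk zero =
      inj₂ (subst (λ z → Reach (ct ∷ []) x (c ⟨$⟩ʳ z)) (transpose-x x y) (Reach-step (here refl) x))
    ·-transpose-walk (suc k) with ·-transpose-walk k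
    ... | inj₁ x~y = inj₁ x~y
    ... | inj₂ x~cᵏy with iterate (suc k) (c ⟨$⟩ʳ_) y ≟ y
    ...   | yes cᵏy≡y = inj₁ (subst (Reach (ct ∷ []) x) cᵏy≡y x~cᵏy)
    ...   | no cᵏy≢y with iterate (suc k) (c ⟨$⟩ʳ_) y ≟ x
    ...     | yes cᵏy≡x = ⊥-elim (¬x~y (Reach-sym (subst (Reach (c ∷ []) y) cᵏy≡x (Reach-iterate c y (suc k)))))
    ...     | no cᵏy≢x = inj₂ (subst (λ z → Reach (ct ∷ []) x (c ⟨$⟩ʳ z)) (transpose-other x y _ cᵏy≢x cᵏy≢y)
                                  (fwd ct (here refl) x~cᵏy))

    Reach-·-transpose : Reach (ct ∷ []) x y
    Reach-·-transpose with iterate-period c y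
    ... | k , cᵏy≡y with ·-transpose-walk k
    ...   | inj₁ x~y    = x~y
    ...   | inj₂ x~cᵏy = subst (Reach (ct ∷ []) x) cᵏy≡y x~cᵏy

    cycles-·-transpose-separated : suc (cycles ct) ≡ cycles c
    cycles-·-transpose-separated =
      trans (cong suc (numOrbits-cong (ct ∷ []) (t ∷ c ∷ []) ct⊑tc tc⊑ct))
            (numOrbits-transpose∷-separated (c ∷ []) ¬x~y)
      where
        ct⊑tc : (ct ∷ []) ⊑ (t ∷ c ∷ [])
        ct⊑tc (here refl) j = fwd c (there (here refl)) (Reach-step (here refl) j)
        tc⊑ct : (t ∷ c ∷ []) ⊑ (ct ∷ [])
        tc⊑ct (here refl) = transpose-within Reach-·-transpose
        tc⊑ct (there (here refl)) j =
          Reach-trans (transpose-within Reach-·-transpose j)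
            (subst (λ z → Reach (ct ∷ []) (t ⟨$⟩ʳ j) (c ⟨$⟩ʳ z)) (transpose-involutive x y j)
              (Reach-step (here refl) (t ⟨$⟩ʳ j)))

  cycles-≤-suc-cycles-·-transpose : ∀ (c : Permutation′ n) x y → cycles c ≤ suc (cycles (c · transpose x y))
  cycles-≤-suc-cycles-·-transpose c x y =
    ≤-trans (numOrbits-≤-transpose∷ (c ∷ []) x y)
      (s≤s (numOrbits-anti (c · transpose x y ∷ []) (transpose x y ∷ c ∷ [])
              λ { (here refl) j → fwd c (there (here refl)) (Reach-step (here refl) j) }))

  numOrbits-c∷t≡t∷c·t : ∀ (c : Permutation′ n) x y R →
    numOrbits (c ∷ transpose x y ∷ R) ≡ numOrbits (transpose x y ∷ c · transpose x y ∷ R)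
  numOrbits-c∷t≡t∷c·t c x y R = numOrbits-cong (c ∷ t ∷ R) (t ∷ c · t ∷ R) forward backward
    where
      t = transpose x y
      forward : (c ∷ t ∷ R) ⊑ (t ∷ c · t ∷ R)
      forward (here refl) j = subst (λ z → Reach _ j (c ⟨$⟩ʳ z)) (transpose-involutive x y j)
                                (fwd (c · t) (there (here refl)) (Reach-step (here refl) j))
      forward (there (here refl)) = Reach-step (here refl)
      forward (there (there m))   = Reach-step (there (there m))
      backward : (t ∷ c · t ∷ R) ⊑ (c ∷ t ∷ R)
      backward (here refl) = Reach-step (there (here refl))
      backward (there (here refl)) j = fwd c (here refl) (Reach-step (there (here refl)) j)
      backward (there (there m))     = Reach-step (there (there m))

  cycles-·-transpose-bound : ∀ (c : Permutation′ n) x y R →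
    cycles c + 2 * numOrbits (c · transpose x y ∷ R)
      ≤ 1 + cycles (c · transpose x y) + 2 * numOrbits (c ∷ transpose x y ∷ R)
  cycles-·-transpose-bound c x y R with Reach? (c · transpose x y ∷ R) x y
  ... | yes x~y = begin
    cycles c + 2 * Z                           ≤⟨ +-monoˡ-≤ _ (cycles-≤-suc-cycles-·-transpose c x y) ⟩
    1 + cycles ct + 2 * Z                      ≡⟨ cong (λ m → 1 + cycles ct + 2 * m) Z≡ ⟩
    1 + cycles ct + 2 * numOrbits (c ∷ t ∷ R)  ∎
    where
      open ≤-Reasoning
      t = transpose x y
      ct = c · t
      Z = numOrbits (ct ∷ R)
      Z≡ : Z ≡ numOrbits (c ∷ t ∷ R)
      Z≡ = trans (sym (numOrbits-transpose∷-connected (ct ∷ R) x~y)) (sym (numOrbits-c∷t≡t∷c·t c x y R))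
  ... | no ¬x~y = ≤-reflexive (begin-equality
    cycles c + 2 * numOrbits (ct ∷ R)
      ≡⟨ cong₂ (λ u v → u + 2 * v) (sym cycles-ctt) (sym joined) ⟩
    cycles (ct · t) + 2 * suc (numOrbits (t ∷ ct ∷ R))
      ≡⟨ shuffle (cycles (ct · t)) (numOrbits (t ∷ ct ∷ R)) ⟩
    1 + suc (cycles (ct · t)) + 2 * numOrbits (t ∷ ct ∷ R)
      ≡⟨ cong₂ (λ u v → 1 + u + 2 * v) merged (sym (numOrbits-c∷t≡t∷c·t c x y R)) ⟩
    1 + cycles ct + 2 * numOrbits (c ∷ t ∷ R)
      ∎)
    where
      open ≤-Reasoning
      t = transpose x y
      ct = c · t
      joined : suc (numOrbits (t ∷ ct ∷ R)) ≡ numOrbits (ct ∷ R)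
      joined = numOrbits-transpose∷-separated (ct ∷ R) ¬x~y
      merged : suc (cycles (ct · t)) ≡ cycles ct
      merged = cycles-·-transpose-separated ct (¬x~y ∘ Reach-⊑ (⊆⇒⊑ λ { (here refl) → here refl }))
      cycles-ctt : cycles (ct · t) ≡ cycles c
      cycles-ctt = cycles-cong (ct · t) c λ j → cong (c ⟨$⟩ʳ_) (transpose-involutive x y j)
      shuffle : ∀ a w → a + 2 * suc w ≡ 1 + suc a + 2 * w
      shuffle = solve-∀

  Reach-fixed : ∀ (g : Permutation′ n) {x z} → g ⟨$⟩ʳ x ≡ x → Reach (g ∷ []) x z → z ≡ x
  Reach-fixed g gx≡x here = refl
  Reach-fixed g gx≡x (fwd _ (here refl) r) rewrite Reach-fixed g gx≡x r = gx≡x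
  Reach-fixed g gx≡x (bwd _ (here refl) r) rewrite Reach-fixed g gx≡x r =
    trans (cong (g ⟨$⟩ˡ_) (sym gx≡x)) (inverseˡ g)

  -- b · (x b⁻¹x) agrees with b except that it fixes x, splitting x off its cycle.
  cycles-·-transpose-preimage : ∀ (b : Permutation′ n) x → b ⟨$⟩ʳ x ≢ x →
                                cycles (b · transpose x (b ⟨$⟩ˡ x)) ≡ suc (cycles b)
  cycles-·-transpose-preimage b x bx≢x =
    trans (sym (cycles-·-transpose-separated b′ ¬x~y)) (cong suc (cycles-cong (b′ · t) b b′t≈b))
    where
      y = b ⟨$⟩ˡ x
      t = transpose x y
      b′ = b · t
      b′x≡x : b′ ⟨$⟩ʳ x ≡ x
      b′x≡x = trans (cong (b ⟨$⟩ʳ_) (transpose-x x y)) (inverseʳ b)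
      ¬x~y : ¬ Reach (b′ ∷ []) x y
      ¬x~y x~y = bx≢x (trans (cong (b ⟨$⟩ʳ_) (sym (Reach-fixed b′ b′x≡x x~y))) (inverseʳ b))
      b′t≈b : b′ · t ≈ b
      b′t≈b j = cong (b ⟨$⟩ʳ_) (transpose-involutive x y j)

  ProductBound : Permutation′ n → Permutation′ n → List (Permutation′ n) → Set
  ProductBound {n} a b R =
    cycles a + cycles b + 2 * numOrbits (a · b ∷ R) ≤ n + cycles (a · b) + 2 * numOrbits (a ∷ b ∷ R)

  ProductBound-id : ∀ (a b : Permutation′ n) R → b ≈ id → ProductBound a b R
  ProductBound-id {n} a b R b≈id = ≤-reflexive (begin
    cycles a + cycles b + 2 * numOrbits (a · b ∷ R)
      ≡⟨ cong₂ (λ u v → cycles a + u + 2 * v) (cycles-id b b≈id) orbits-ab≡a ⟩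
    cycles a + n + 2 * numOrbits (a ∷ R)
      ≡⟨ cong (_+ 2 * numOrbits (a ∷ R)) (+-comm (cycles a) n) ⟩
    n + cycles a + 2 * numOrbits (a ∷ R)
      ≡⟨ cong₂ (λ u v → n + u + 2 * v) (sym cycles-ab≡a) (sym orbits-a∷b≡a) ⟩
    n + cycles (a · b) + 2 * numOrbits (a ∷ b ∷ R)
      ∎)
    where
      open ≡-Reasoning
      ab≈a : a · b ≈ a
      ab≈a j = cong (a ⟨$⟩ʳ_) (b≈id j)
      cycles-ab≡a : cycles (a · b) ≡ cycles a
      cycles-ab≡a = cycles-cong (a · b) a ab≈a
      orbits-ab≡a : numOrbits (a · b ∷ R) ≡ numOrbits (a ∷ R)
      orbits-ab≡a = numOrbits-∷-≈ (a · b) a R ab≈a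
      ab⊑a : (a ∷ b ∷ R) ⊑ (a ∷ R)
      ab⊑a (here refl)         = Reach-step (here refl)
      ab⊑a (there (here refl)) j = subst (Reach _ j) (sym (b≈id j)) here
      ab⊑a (there (there m))   = Reach-step (there m)
      a⊑ab : (a ∷ R) ⊑ (a ∷ b ∷ R)
      a⊑ab (here refl) = Reach-step (here refl)
      a⊑ab (there m)   = Reach-step (there (there m))
      orbits-a∷b≡a : numOrbits (a ∷ b ∷ R) ≡ numOrbits (a ∷ R)
      orbits-a∷b≡a = numOrbits-cong (a ∷ b ∷ R) (a ∷ R) ab⊑a a⊑ab

  -- Factor b = b′ · t with t = (x b⁻¹x), apply the bound to a, b′ and then to a · b′, t.
  ProductBound-step : ∀ (a b : Permutation′ n) R x → b ⟨$⟩ʳ x ≢ x →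
    ProductBound a (b · transpose x (b ⟨$⟩ˡ x)) (transpose x (b ⟨$⟩ˡ x) ∷ R) → ProductBound a b R
  ProductBound-step {n} a b R x bx≢x bound′ =
    +-cancelʳ-≤ (cycles (a · b′) + 1 + 2 * Q) _ _ (begin
      cycles a + cycles b + 2 * Z + (cycles (a · b′) + 1 + 2 * Q)
        ≡⟨ shuffleˡ (cycles a) (cycles b) Z (cycles (a · b′)) Q ⟩
      (cycles a + suc (cycles b) + 2 * Q) + (cycles (a · b′) + 2 * Z)
        ≤⟨ +-mono-≤ bound″ transposition ⟩
      (n + cycles (a · b′) + 2 * P) + (1 + cycles (a · b) + 2 * Q)
        ≡⟨ shuffleʳ n (cycles (a · b′)) P (cycles (a · b)) Q ⟩
      n + cycles (a · b) + 2 * P + (cycles (a · b′) + 1 + 2 * Q)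
        ∎)
    where
      open ≤-Reasoning
      y = b ⟨$⟩ˡ x
      t = transpose x y
      b′ = b · t
      P = numOrbits (a ∷ b ∷ R)
      Q = numOrbits (a · b′ ∷ t ∷ R)
      Z = numOrbits (a · b ∷ R)
      ab′t≈ab : (a · b′) · t ≈ a · b
      ab′t≈ab j = cong (λ z → a ⟨$⟩ʳ (b ⟨$⟩ʳ z)) (transpose-involutive x y j)
      x~y : Reach (a ∷ b ∷ R) x y
      x~y = Reach-stepˡ (there (here refl)) x
      same-orbits : numOrbits (a ∷ b′ ∷ t ∷ R) ≡ P
      same-orbits = numOrbits-cong (a ∷ b′ ∷ t ∷ R) (a ∷ b ∷ R) forward backward
        where
          forward : (a ∷ b′ ∷ t ∷ R) ⊑ (a ∷ b ∷ R)
          forward (here refl)                 = Reach-step (here refl)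
          forward (there (here refl)) j       = fwd b (there (here refl)) (transpose-within x~y j)
          forward (there (there (here refl))) = transpose-within x~y
          forward (there (there (there m)))   = Reach-step (there (there m))
          backward : (a ∷ b ∷ R) ⊑ (a ∷ b′ ∷ t ∷ R)
          backward (here refl)         = Reach-step (here refl)
          backward (there (here refl)) j =
            subst (λ z → Reach _ j (b ⟨$⟩ʳ z)) (transpose-involutive x y j)
              (fwd b′ (there (here refl)) (Reach-step (there (there (here refl))) j))
          backward (there (there m))   = Reach-step (there (there (there m)))
      bound″ : cycles a + suc (cycles b) + 2 * Q ≤ n + cycles (a · b′) + 2 * P
      bound″ = subst₂ (λ u v → cycles a + u + 2 * Q ≤ n + cycles (a · b′) + 2 * v)
                 (cycles-·-transpose-preimage b x bx≢x) same-orbits bound′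
      transposition : cycles (a · b′) + 2 * Z ≤ 1 + cycles (a · b) + 2 * Q
      transposition = subst₂ (λ u v → cycles (a · b′) + 2 * v ≤ 1 + u + 2 * Q)
                        (cycles-cong ((a · b′) · t) (a · b) ab′t≈ab)
                        (numOrbits-∷-≈ ((a · b′) · t) (a · b) R ab′t≈ab)
                        (cycles-·-transpose-bound (a · b′) x y R)
      shuffleˡ : ∀ ca cb z cab′ q → ca + cb + 2 * z + (cab′ + 1 + 2 * q) ≡ (ca + suc cb + 2 * q) + (cab′ + 2 * z)
      shuffleˡ = solve-∀
      shuffleʳ : ∀ n cab′ p cab q → (n + cab′ + 2 * p) + (1 + cab + 2 * q) ≡ n + cab + 2 * p + (cab′ + 1 + 2 * q)
      shuffleʳ = solve-∀

  cycles-<-moved : ∀ (b : Permutation′ n) x → b ⟨$⟩ʳ x ≢ x → cycles b < n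
  cycles-<-moved b x bx≢x =
    subst (_≤ _) (cycles-·-transpose-preimage b x bx≢x) (cycles-≤ (b · transpose x (b ⟨$⟩ˡ x)))

  ProductBound-by-norm : ∀ m (a b : Permutation′ n) R → m + cycles b ≡ n → ProductBound a b R
  ProductBound-by-norm {n} m a b R m+#b≡n with all? (λ j → b ⟨$⟩ʳ j ≟ j)
  ... | yes b≈id = ProductBound-id a b R b≈id
  ... | no b≉id with ¬∀⟶∃¬ n _ (λ j → b ⟨$⟩ʳ j ≟ j) b≉id
  ...   | x , bx≢x with m
  ...     | zero   = ⊥-elim (<-irrefl m+#b≡n (cycles-<-moved b x bx≢x))
  ...     | suc m′ = ProductBound-step a b R x bx≢x (ProductBound-by-norm m′ a (b · t) (t ∷ R) m′+#b′≡n)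
    where
      t = transpose x (b ⟨$⟩ˡ x)
      m′+#b′≡n : m′ + cycles (b · t) ≡ n
      m′+#b′≡n = trans (cong (m′ +_) (cycles-·-transpose-preimage b x bx≢x)) (trans (+-suc m′ (cycles b)) m+#b≡n)

  productBound : ∀ (a b : Permutation′ n) R → ProductBound a b R
  productBound a b R = ProductBound-by-norm ‖ b ‖ a b R (m∸n+n≡m (cycles-≤ b))

  ‖‖+cycles : (g : Permutation′ n) → ‖ g ‖ + cycles g ≡ n
  ‖‖+cycles g = m∸n+n≡m (cycles-≤ g)

  productBound-prod : ∀ (ρs R : List (Permutation′ n)) →
    n + 2 * numOrbits (prod ρs ∷ R) ≤ sum (map ‖_‖ ρs) + cycles (prod ρs) + 2 * numOrbits (ρs ++ R)
  productBound-prod {n} [] R = ≤-reflexive (cong₂ (λ u v → u + 2 * v)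
    (sym (cycles-id {n} id λ _ → refl)) (numOrbits-redundant {gs = R} id λ _ → here))
  productBound-prod {n} (ρ ∷ ρs) R = begin
    n + 2 * Z                 ≡⟨ cong (_+ 2 * Z) (sym (‖‖+cycles ρ)) ⟩
    ‖ ρ ‖ + cycles ρ + 2 * Z  ≡⟨ +-assoc ‖ ρ ‖ (cycles ρ) (2 * Z) ⟩
    ‖ ρ ‖ + (cycles ρ + 2 * Z) ≤⟨ +-monoʳ-≤ ‖ ρ ‖ core ⟩
    ‖ ρ ‖ + (S + A + 2 * X)    ≡⟨ reassoc ‖ ρ ‖ S A X ⟩
    ‖ ρ ‖ + S + A + 2 * X     ∎
    where
      open ≤-Reasoning
      π = prod ρs
      S = sum (map ‖_‖ ρs)
      A = cycles (ρ · π)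
      X = numOrbits (ρ ∷ ρs ++ R)
      Y = numOrbits (ρ ∷ π ∷ R)
      Z = numOrbits (ρ · π ∷ R)
      previous : n + 2 * Y ≤ S + cycles π + 2 * X
      previous = subst₂ (λ u v → n + 2 * u ≤ S + cycles π + 2 * v)
                   (numOrbits-↭ {gs = π ∷ ρ ∷ R} (↭-swap π ρ ↭-refl))
                   (numOrbits-↭ {gs = ρs ++ ρ ∷ R} (shift ρ ρs R))
                   (productBound-prod ρs (ρ ∷ R))
      core : cycles ρ + 2 * Z ≤ S + A + 2 * X
      core = +-cancelʳ-≤ (n + 2 * Y + cycles π) _ _ (begin
        cycles ρ + 2 * Z + (n + 2 * Y + cycles π)          ≡⟨ shuffleˡ (cycles ρ) Z n Y (cycles π) ⟩
        (n + 2 * Y) + (cycles ρ + cycles π + 2 * Z)        ≤⟨ +-mono-≤ previous (productBound ρ π R) ⟩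
        (S + cycles π + 2 * X) + (n + A + 2 * Y)           ≡⟨ shuffleʳ S (cycles π) X n A Y ⟩
        S + A + 2 * X + (n + 2 * Y + cycles π)             ∎)
        where
          shuffleˡ : ∀ r z n y p → r + 2 * z + (n + 2 * y + p) ≡ (n + 2 * y) + (r + p + 2 * z)
          shuffleˡ = solve-∀
          shuffleʳ : ∀ s p x n a y → (s + p + 2 * x) + (n + a + 2 * y) ≡ s + a + 2 * x + (n + 2 * y + p)
          shuffleʳ = solve-∀
      reassoc : ∀ r s a x → r + (s + a + 2 * x) ≡ r + s + a + 2 * x
      reassoc = solve-∀

  genus-nonnegative : ∀ (σ τ : Permutation′ n) → cycles σ + cycles τ ≤ ‖ σ · τ ⁻¹ ‖ + 2 * numΠ σ τ
  genus-nonnegative {n} σ τ = +-cancelʳ-≤ (2 * cycles π) _ _ (begin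
    cycles σ + cycles τ + 2 * cycles π
      ≡⟨ cong (λ c → cycles σ + c + 2 * cycles π) (sym (cycles-⁻¹ τ)) ⟩
    cycles σ + cycles (τ ⁻¹) + 2 * numOrbits (π ∷ [])
      ≤⟨ productBound σ (τ ⁻¹) [] ⟩
    n + cycles π + 2 * numOrbits (σ ∷ τ ⁻¹ ∷ [])
      ≡⟨ cong₂ (λ m o → m + cycles π + 2 * o) (sym (‖‖+cycles π)) Π≡ ⟩
    ‖ π ‖ + cycles π + cycles π + 2 * numΠ σ τ
      ≡⟨ shuffle ‖ π ‖ (cycles π) (numΠ σ τ) ⟩
    ‖ π ‖ + 2 * numΠ σ τ + 2 * cycles π
      ∎)
    where
      open ≤-Reasoning
      π = σ · τ ⁻¹
      Π≡ : numOrbits (σ ∷ τ ⁻¹ ∷ []) ≡ numΠ σ τ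
      Π≡ = numOrbits-cong (σ ∷ τ ⁻¹ ∷ []) (σ ∷ τ ∷ [])
        (λ { (here refl) → Reach-step (here refl) ; (there (here refl)) → Reach-stepˡ (there (here refl)) })
        (λ { (here refl) → Reach-step (here refl) ; (there (here refl)) → Reach-stepˡ (there (here refl)) })
      shuffle : ∀ m c p → m + c + c + 2 * p ≡ m + 2 * p + 2 * c
      shuffle = solve-∀

  factorisation-bound : ∀ {k} (σ τ : Permutation′ (suc k)) (ρs : List (Permutation′ (suc k))) →
    prod ρs ≈ σ · τ ⁻¹ → Transitive (σ ∷ τ ∷ ρs) →
    ‖ σ · τ ⁻¹ ‖ + 2 * numΠ σ τ ≤ sum (map ‖_‖ ρs) + 2
  factorisation-bound {k} σ τ ρs prod≈π transitive = +-cancelʳ-≤ (cycles π) _ _ (begin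
    ‖ π ‖ + 2 * numΠ σ τ + cycles π
      ≡⟨ shuffle ‖ π ‖ (numΠ σ τ) (cycles π) ⟩
    ‖ π ‖ + cycles π + 2 * numΠ σ τ
      ≡⟨ cong₂ (λ m o → m + 2 * o) (‖‖+cycles π) (sym Π≡) ⟩
    suc k + 2 * numOrbits (prod ρs ∷ σ ∷ τ ∷ [])
      ≤⟨ productBound-prod ρs (σ ∷ τ ∷ []) ⟩
    S + cycles (prod ρs) + 2 * numOrbits (ρs ++ σ ∷ τ ∷ [])
      ≡⟨ cong₂ (λ c o → S + c + 2 * o) (cycles-cong (prod ρs) π prod≈π) one-orbit ⟩
    S + cycles π + 2 * 1
      ≡⟨ shuffle S 1 (cycles π) ⟨
    S + 2 + cycles π
      ∎)
    where
      open ≤-Reasoning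
      π = σ · τ ⁻¹
      S = sum (map ‖_‖ ρs)
      Π≡ : numOrbits (prod ρs ∷ σ ∷ τ ∷ []) ≡ numΠ σ τ
      Π≡ = numOrbits-redundant {gs = σ ∷ τ ∷ []} (prod ρs) λ j →
        subst (Reach _ j) (sym (prod≈π j)) (fwd σ (here refl) (Reach-stepˡ (there (here refl)) j))
      one-orbit : numOrbits (ρs ++ σ ∷ τ ∷ []) ≡ 1
      one-orbit = trans (numOrbits-↭ {gs = ρs ++ σ ∷ τ ∷ []} {hs = σ ∷ τ ∷ ρs} (++-comm ρs (σ ∷ τ ∷ [])))
                        (numOrbits-transitive (σ ∷ τ ∷ ρs) transitive)
      shuffle : ∀ m p c → m + 2 * p + c ≡ m + c + 2 * p
      shuffle = solve-∀

open OrbitCounting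
open import Data.Nat using (ℕ; zero; suc)
import Data.Nat as ℕ
import Data.Nat.Properties as ℕₚ
open import Data.Nat.ListAction using (sum)
open import Data.List.Relation.Unary.All using (All)
open import Data.Integer using (ℤ; +_; _+_; _-_)
import Data.Integer as ℤ
import Data.Integer.Properties as ℤₚ
open import Data.Integer.Tactic.RingSolver using (solve-∀)

+s≡+a++b-2⇒s+2≡a+b : ∀ {s} a b → + s ≡ + a + + b - + 2 → s ℕ.+ 2 ≡ a ℕ.+ b
+s≡+a++b-2⇒s+2≡a+b {s} a b eq = ℤₚ.+-injective (begin
  + (s ℕ.+ 2)            ≡⟨ ℤₚ.pos-+ s 2 ⟩
  + s + + 2              ≡⟨ cong (_+ + 2) eq ⟩
  + a + + b - + 2 + + 2  ≡⟨ cancel (+ a) (+ b) ⟩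
  + a + + b              ≡⟨ ℤₚ.pos-+ a b ⟨
  + (a ℕ.+ b)            ∎)
  where
    open ≡-Reasoning
    cancel : ∀ x y → x + y - + 2 + + 2 ≡ x + y
    cancel = solve-∀

pos-+≡pos-+2* : ∀ a b m p → a ℕ.+ b ≡ m ℕ.+ 2 ℕ.* p → + a + + b ≡ + m + + 2 ℤ.* + p
pos-+≡pos-+2* a b m p eq = begin
  + a + + b            ≡⟨ ℤₚ.pos-+ a b ⟨
  + (a ℕ.+ b)          ≡⟨ cong +_ eq ⟩
  + (m ℕ.+ 2 ℕ.* p)    ≡⟨ ℤₚ.pos-+ m (2 ℕ.* p) ⟩
  + m + + (2 ℕ.* p)    ≡⟨ cong (λ z → + m + z) (ℤₚ.pos-* 2 p) ⟩
  + m + + 2 ℤ.* + p    ∎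
  where open ≡-Reasoning

module _ {n : ℕ} (σ τ : Permutation′ n)
         (tight : cycles σ ℕ.+ cycles τ ≡ ‖ σ · τ ⁻¹ ‖ ℕ.+ 2 ℕ.* numΠ σ τ) where
  private
    π = σ · τ ⁻¹
    P = numΠ σ τ
    tightℤ : + cycles σ + + cycles τ ≡ + ‖ π ‖ + + 2 ℤ.* + P
    tightℤ = pos-+≡pos-+2* (cycles σ) (cycles τ) ‖ π ‖ P tight

  isGenus-zero : IsGenus σ τ (+ 0)
  isGenus-zero = begin
    + cycles σ + + cycles (τ ⁻¹) - + n + + cycles π
      ≡⟨ cong₂ (λ c m → + cycles σ + + c - + m + + cycles π) (cycles-⁻¹ τ) (sym (‖‖+cycles π)) ⟩
    + cycles σ + + cycles τ - + (‖ π ‖ ℕ.+ cycles π) + + cycles π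
      ≡⟨ cong (λ m → + cycles σ + + cycles τ - m + + cycles π) (ℤₚ.pos-+ ‖ π ‖ (cycles π)) ⟩
    + cycles σ + + cycles τ - (+ ‖ π ‖ + + cycles π) + + cycles π
      ≡⟨ cancelˡ (+ cycles σ) (+ cycles τ) (+ ‖ π ‖) (+ cycles π) ⟩
    + cycles σ + + cycles τ - + ‖ π ‖
      ≡⟨ cong (_- + ‖ π ‖) tightℤ ⟩
    + ‖ π ‖ + + 2 ℤ.* + P - + ‖ π ‖
      ≡⟨ cancelʳ (+ ‖ π ‖) (+ P) ⟩
    + 2 ℤ.* + P - + 2 ℤ.* + 0
      ∎
    where
      open ≡-Reasoning
      cancelˡ : ∀ a b m c → a + b - (m + c) + c ≡ a + b - m
      cancelˡ = solve-∀
      cancelʳ : ∀ m p → m + + 2 ℤ.* p - m ≡ + 2 ℤ.* p - + 2 ℤ.* + 0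
      cancelʳ = solve-∀

  #σ+#τ-2≡ℓ : + cycles σ + + cycles τ - + 2 ≡ ℓ σ τ
  #σ+#τ-2≡ℓ = begin
    + cycles σ + + cycles τ - + 2      ≡⟨ cong (_- + 2) tightℤ ⟩
    + ‖ π ‖ + + 2 ℤ.* + P - + 2        ≡⟨ factor-2 (+ ‖ π ‖) (+ P) ⟩
    ℓ σ τ                              ∎
    where
      open ≡-Reasoning
      factor-2 : ∀ m p → m + + 2 ℤ.* p - + 2 ≡ m + + 2 ℤ.* (p - + 1)
      factor-2 = solve-∀

corollary4p4 : ∀ (n : ℕ) (σ τ : Permutation′ n) (ρs : List (Permutation′ n)) (l : ℤ) →
    All (λ ρ → ¬ (ρ ≈ id)) ρs →
    prod ρs ≈ σ · τ ⁻¹ →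
    l ≡ + cycles σ + + cycles τ - + 2 →
    + sum (map ‖_‖ ρs) ≡ l →
    Transitive (σ ∷ τ ∷ ρs) →
    IsGenus σ τ (+ 0) × l ≡ ℓ σ τ
-- For n = 0 every cycle count is 0, so l = −2 cannot be a sum of norms.
corollary4p4 zero σ τ ρs l _ _ l≡ S≡l _ with trans S≡l l≡
... | ()
-- The ρᵢ need not be non-identity for this conclusion.
corollary4p4 (suc k) σ τ ρs l _ prod≈π l≡ S≡l transitive =
  isGenus-zero σ τ tight , trans l≡ (#σ+#τ-2≡ℓ σ τ tight)
  where
    tight : cycles σ ℕ.+ cycles τ ≡ ‖ σ · τ ⁻¹ ‖ ℕ.+ 2 ℕ.* numΠ σ τ
    tight = ℕₚ.≤-antisym (genus-nonnegative σ τ)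
      (ℕₚ.≤-trans (factorisation-bound σ τ ρs prod≈π transitive)
        (ℕₚ.≤-reflexive (+s≡+a++b-2⇒s+2≡a+b (cycles σ) (cycles τ) (trans S≡l l≡))))
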